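{- If $G$ is a (finite, simple) bipartite graph without isolated vertices, then $\chi'_{CF}(G)\leq 4$.
   Context: For a graph $G=(V,E)$ and a vertex $v$, let $E_G(v)$ be the set of edges incident to $v$, and for an edge $uv$ let $E_G[uv]=E_G(u)\cup E_G(v)$ (the closed neighbourhood of $uv$, which contains $uv$ itself). An edge colouring $c$ of $G$ (not necessarily proper) is conflict-free if for every edge $e$ of $G$ some colour occurs on exactly one edge of $E_G[e]$. The conflict-free chromatic index $\chi'_{CF}(G)$ is the least number of colours admitting a conflict-free edge colouring of $G$. -}

module Defs where

open import Data.Nat using (ℕ)
open import Data.Bool using (Bool; true; false; _∧_; _∨_)
open import Data.Fin using (Fin; _<?_) renaming (_≟_ to _≟ᶠ_)
open import Data.List using (List; filterᵇ; length; allFin; cartesianProduct)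
open import Data.Product using (_×_; _,_; ∃; ∃-syntax; Σ)
open import Relation.Nullary.Decidable using (⌊_⌋)
open import Relation.Binary.PropositionalEquality using (_≡_; _≢_)

record Graph (n : ℕ) : Set where
  field
    adj   : Fin n → Fin n → Bool
    sym   : ∀ u v → adj u v ≡ adj v u
    irrefl : ∀ v → adj v v ≡ false
open Graph public

Bipartite : ∀ {n} → Graph n → Set
Bipartite {n} G = Σ (Fin n → Bool) λ side →
  ∀ u v → adj G u v ≡ true → side u ≢ side v

NoIsolated : ∀ {n} → Graph n → Set
NoIsolated {n} G = ∀ (v : Fin n) → ∃[ u ] adj G v u ≡ true

-- The edge set: each edge {x,y} is listed exactly once, as the pair (x , y) with x < y.
Edges : ∀ {n} → Graph n → List (Fin n × Fin n)
Edges {n} G = filterᵇ (λ { (x , y) → ⌊ x <? y ⌋ ∧ adj G x y })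
                      (cartesianProduct (allFin n) (allFin n))

-- An edge colouring with k colours: a colour for each edge (x , y), x < y
-- (values on other pairs are irrelevant).
EdgeColouring : ℕ → ℕ → Set
EdgeColouring n k = Fin n → Fin n → Fin k

InClosedNbhd : ∀ {n} → Fin n → Fin n → Fin n × Fin n → Bool
InClosedNbhd u v (x , y) =
  ⌊ x ≟ᶠ u ⌋ ∨ ⌊ x ≟ᶠ v ⌋ ∨ ⌊ y ≟ᶠ u ⌋ ∨ ⌊ y ≟ᶠ v ⌋

countColour : ∀ {n k} → Graph n → EdgeColouring n k → Fin n → Fin n → Fin k → ℕ
countColour G c u v col =
  length (filterᵇ (λ { (x , y) → InClosedNbhd u v (x , y) ∧ ⌊ c x y ≟ᶠ col ⌋ }) (Edges G))

ConflictFree : ∀ {n k} → Graph n → EdgeColouring n k → Set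
ConflictFree {n} {k} G c =
  ∀ (u v : Fin n) → adj G u v ≡ true → ∃[ col ] countColour G c u v col ≡ 1

CFIndexAtMost : ∀ {n} → Graph n → ℕ → Set
CFIndexAtMost {n} G k = Σ (EdgeColouring n k) λ c → ConflictFree G c

{-# OPTIONS --safe #-}
module Submission where

-- Let A be one side of the bipartition and S a minimal set of vertices dominating A, which
-- exists since no vertex is isolated. Every a ∈ A has a neighbour p a ∈ S, and by minimality
-- every w ∈ S has a private neighbour q w ∈ A, one whose only neighbour in S is w; hence
-- p (q w) = w. Colour an edge ab with a ∈ A by 2 if b ≠ p a, by 0 if b = p a and a = q b,
-- and by 1 otherwise. Take an edge a₀b₀. If b₀ ∈ S, then (q b₀) b₀ is the only edge of
-- colour 0 meeting a₀ or b₀. Otherwise a₀ (p a₀) is the only edge of its colour there: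
-- edges not coloured 2 have the form a (p a), and b₀ ∉ S is not of the form p a.
-- So three colours already suffice.

open import Defs hiding (sym)
open import Data.Nat using (ℕ)
open import Data.Bool using (Bool; true; false; not; T; T?; _∧_; if_then_else_)
open import Data.Bool.Properties using (T-∧; T-≡; ¬-not) renaming (_≟_ to _≟ᵇ_)
open import Data.Empty using (⊥; ⊥-elim)
open import Data.Fin using (Fin; _<_; _≟_; #_)
open import Data.Fin.Properties using (all?; any?; ¬∀⟶∃¬; <-cmp; <-asym)
open import Data.List using (List; []; _∷_; length; filterᵇ; foldl; allFin; cartesianProduct)
open import Data.List.Membership.Propositional using (_∈_)
open import Data.List.Membership.Propositional.Properties
  using (∈-filter⁺; ∈-filter⁻; ∈-cartesianProduct⁺; ∈-allFin)
open import Data.List.Relation.Unary.Any using (here; there)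
open import Data.List.Relation.Unary.AllPairs using (_∷_)
open import Data.List.Relation.Unary.All using (_∷_)
open import Data.List.Relation.Unary.Unique.Propositional using (Unique)
open import Data.List.Relation.Unary.Unique.Propositional.Properties
  using (filter⁺; cartesianProduct⁺; allFin⁺)
open import Data.Product using (_×_; _,_; proj₁; proj₂; Σ; ∃-syntax; swap)
open import Data.Sum using (_⊎_; inj₁; inj₂)
import Data.Sum as Sum
open import Function using (_∘_; id)
open import Function.Bundles using (Equivalence)
open import Relation.Binary.Definitions using (tri<; tri≈; tri>)
open import Relation.Binary.PropositionalEquality
  using (_≡_; _≢_; refl; sym; trans; cong; cong₂; subst)
open import Relation.Nullary using (¬_; Dec; does; yes; no; contradiction)
open import Relation.Nullary.Decidable using (⌊_⌋; toWitness; fromWitness; dec-true; dec-false; _×-dec_; _→-dec_)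

Unique⇒length≡1 : ∀ {A : Set} {x : A} {ys : List A} →
                  Unique ys → x ∈ ys → (∀ {y} → y ∈ ys → y ≡ x) → length ys ≡ 1
Unique⇒length≡1 {ys = _ ∷ []}    _                _ _    = refl
Unique⇒length≡1 {ys = _ ∷ _ ∷ _} ((y≢z ∷ _) ∷ _) _ all≡ =
  contradiction (trans (all≡ (here refl)) (sym (all≡ (there (here refl))))) y≢z

length-filterᵇ≡1 : ∀ {A : Set} (P : A → Bool) {xs : List A} {x : A} →
                   Unique xs → x ∈ xs → T (P x) →
                   (∀ {y} → y ∈ xs → T (P y) → y ≡ x) → length (filterᵇ P xs) ≡ 1
length-filterᵇ≡1 P uniq x∈xs Px only-x =
  Unique⇒length≡1 (filter⁺ (T? ∘ P) uniq) (∈-filter⁺ (T? ∘ P) x∈xs Px)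
    (λ y∈ → let (y∈xs , Py) = ∈-filter⁻ (T? ∘ P) y∈ in only-x y∈xs Py)

guardedChoice : ∀ {A X : Set} {P : A → X → Set} (g : A → Bool) → (A → X) →
                (∀ a → g a ≡ true → Σ X (P a)) →
                Σ (A → X) λ f → ∀ a → g a ≡ true → P a (f a)
guardedChoice {X = X} {P = P} g default choose = (λ a → pick a (g a) refl) , (λ a → pick-spec a (g a) refl)
  where
  pick : ∀ a b → g a ≡ b → X
  pick a true  ga = proj₁ (choose a ga)
  pick a false _  = default a

  pick-spec : ∀ a b (ga : g a ≡ b) → b ≡ true → P a (pick a b ga)
  pick-spec a true ga _ = proj₂ (choose a ga)

module _ {n : ℕ} where

  _⊆_ : (S T : Fin n → Bool) → Set
  S ⊆ T = ∀ {x} → S x ≡ true → T x ≡ true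

  _∖_ : (Fin n → Bool) → Fin n → Fin n → Bool
  (S ∖ w) x = if does (x ≟ w) then false else S x

  ∖-self : ∀ S w → (S ∖ w) w ≡ false
  ∖-self S w rewrite dec-true (w ≟ w) refl = refl

  ∖-⊆ : ∀ S w → (S ∖ w) ⊆ S
  ∖-⊆ S w {x} with x ≟ w
  ... | yes _ = λ ()
  ... | no _  = id

  ∖-mono : ∀ {S T} w → S ⊆ T → (S ∖ w) ⊆ (T ∖ w)
  ∖-mono w S⊆T {x} with x ≟ w
  ... | yes _ = id
  ... | no _  = S⊆T

  ∈-∖ : ∀ {S x w} → S x ≡ true → x ≢ w → (S ∖ w) x ≡ true
  ∈-∖ {x = x} {w} Sx x≢w rewrite dec-false (x ≟ w) x≢w = Sx

  Minimal : ((Fin n → Bool) → Set) → (Fin n → Bool) → Set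
  Minimal Φ S = ∀ w → S w ≡ true → ¬ Φ (S ∖ w)

  module _ {Φ : (Fin n → Bool) → Set} (Φ? : ∀ S → Dec (Φ S))
           (Φ-mono : ∀ {S T} → S ⊆ T → Φ S → Φ T) where

    prune : (Fin n → Bool) → Fin n → Fin n → Bool
    prune S w with Φ? (S ∖ w)
    ... | yes _ = S ∖ w
    ... | no _  = S

    prune-⊆ : ∀ S w → prune S w ⊆ S
    prune-⊆ S w with Φ? (S ∖ w)
    ... | yes _ = ∖-⊆ S w
    ... | no _  = id

    prune-Φ : ∀ S w → Φ S → Φ (prune S w)
    prune-Φ S w ΦS with Φ? (S ∖ w)
    ... | yes ΦS∖w = ΦS∖w
    ... | no _     = ΦS

    prune-minimal : ∀ S w → prune S w w ≡ true → ¬ Φ (prune S w ∖ w)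
    prune-minimal S w with Φ? (S ∖ w)
    ... | yes _   = λ S∖w-w → contradiction (trans (sym S∖w-w) (∖-self S w)) λ ()
    ... | no ¬ΦS∖w = λ _ → ¬ΦS∖w

    pruneAll-⊆ : ∀ S ws → foldl prune S ws ⊆ S
    pruneAll-⊆ S []       = id
    pruneAll-⊆ S (w ∷ ws) = prune-⊆ S w ∘ pruneAll-⊆ (prune S w) ws

    pruneAll-Φ : ∀ S ws → Φ S → Φ (foldl prune S ws)
    pruneAll-Φ S []       = id
    pruneAll-Φ S (w ∷ ws) = pruneAll-Φ (prune S w) ws ∘ prune-Φ S w

    pruneAll-minimal : ∀ S ws {w} → w ∈ ws → foldl prune S ws w ≡ true → ¬ Φ (foldl prune S ws ∖ w)
    pruneAll-minimal S (w ∷ ws) (here refl) Mw =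
      prune-minimal S w (pruneAll-⊆ (prune S w) ws Mw)
      ∘ Φ-mono (∖-mono {foldl prune (prune S w) ws} w (pruneAll-⊆ (prune S w) ws))
    pruneAll-minimal S (_ ∷ ws) (there w∈ws) = pruneAll-minimal (prune _ _) ws w∈ws

    minimalSubset : ∀ {S} → Φ S → ∃[ M ] Φ M × Minimal Φ M
    minimalSubset {S} ΦS =
      foldl prune S (allFin n) , pruneAll-Φ S (allFin n) ΦS ,
      λ w → pruneAll-minimal S (allFin n) (∈-allFin w)

module _ {n : ℕ} (G : Graph n) where

  private
    allPairs : List (Fin n × Fin n)
    allPairs = cartesianProduct (allFin n) (allFin n)

  Edges-unique : Unique (Edges G)
  Edges-unique = filter⁺ _ (cartesianProduct⁺ (allFin⁺ n) (allFin⁺ n))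

  ∈-Edges⁺ : ∀ {x y} → x < y → adj G x y ≡ true → (x , y) ∈ Edges G
  ∈-Edges⁺ {x} {y} x<y xy =
    ∈-filter⁺ _ {xs = allPairs} (∈-cartesianProduct⁺ (∈-allFin x) (∈-allFin y))
      (Equivalence.from T-∧ (fromWitness x<y , Equivalence.from T-≡ xy))

  ∈-Edges⁻ : ∀ {x y} → (x , y) ∈ Edges G → x < y × adj G x y ≡ true
  ∈-Edges⁻ xy∈ =
    let (x<y , xy) = Equivalence.to T-∧ (proj₂ (∈-filter⁻ _ {xs = allPairs} xy∈))
    in toWitness x<y , Equivalence.to T-≡ xy

  Dominated : (Fin n → Bool) → Fin n → Set
  Dominated S a = ∃[ w ] S w ≡ true × adj G a w ≡ true

  Dominates : (A S : Fin n → Bool) → Set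
  Dominates A S = ∀ a → A a ≡ true → Dominated S a

  PrivateNeighbour : (A S : Fin n → Bool) → Fin n → Fin n → Set
  PrivateNeighbour A S w a =
    A a ≡ true × adj G a w ≡ true × (∀ b → adj G a b ≡ true → S b ≡ true → b ≡ w)

  dominated? : ∀ (S : Fin n → Bool) a → Dec (Dominated S a)
  dominated? S a = any? λ w → (S w ≟ᵇ true) ×-dec (adj G a w ≟ᵇ true)

  dominatedIfIn? : ∀ (A S : Fin n → Bool) a → Dec (A a ≡ true → Dominated S a)
  dominatedIfIn? A S a = (A a ≟ᵇ true) →-dec dominated? S a

  dominates? : ∀ (A S : Fin n → Bool) → Dec (Dominates A S)
  dominates? A S = all? (dominatedIfIn? A S)

  dominates-mono : ∀ {A S T : Fin n → Bool} → S ⊆ T → Dominates A S → Dominates A T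
  dominates-mono S⊆T dom a Aa = let (w , Sw , aw) = dom a Aa in w , S⊆T Sw , aw

  minimalDominatingSet : ∀ {A : Fin n → Bool} → (∀ a → A a ≡ true → ∃[ w ] adj G a w ≡ true) →
                         ∃[ S ] Dominates A S × Minimal (Dominates A) S
  minimalDominatingSet {A} hasNeighbour =
    minimalSubset (dominates? A) dominates-mono
      λ a Aa → let (w , aw) = hasNeighbour a Aa in w , refl , aw

  minimal⇒privateNeighbour : ∀ {A S : Fin n → Bool} → Dominates A S → Minimal (Dominates A) S →
                             ∀ w → S w ≡ true → ∃[ a ] PrivateNeighbour A S w a
  minimal⇒privateNeighbour {A} {S} dom minimal w Sw
    with ¬∀⟶∃¬ n _ (dominatedIfIn? A (S ∖ w)) (minimal w Sw)
  ... | a , ¬dom-a with A a in Aa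
  ...   | false = contradiction (λ ()) ¬dom-a
  ...   | true  = let (b , Sb , ab) = dom a Aa in
                  a , Aa , subst (λ v → adj G a v ≡ true) (only-w b ab Sb) ab , only-w
    where
    -- any other neighbour of a in S would dominate a in S ∖ w
    only-w : ∀ b → adj G a b ≡ true → S b ≡ true → b ≡ w
    only-w b ab Sb with b ≟ w
    ... | yes b≡w = b≡w
    ... | no b≢w  = contradiction (λ _ → b , ∈-∖ {S = S} Sb b≢w , ab) ¬dom-a

module _ {n : ℕ} where

  _∈ₑ_ : Fin n → Fin n × Fin n → Set
  z ∈ₑ (x , y) = z ≡ x ⊎ z ≡ y

  Shares : Fin n × Fin n → Fin n × Fin n → Set
  Shares e f = ∃[ z ] z ∈ₑ e × z ∈ₑ f

  InClosedNbhd⁺ : ∀ {u v x y} → Shares (x , y) (u , v) → T (InClosedNbhd u v (x , y))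
  InClosedNbhd⁺ {u} {v} {x} {y} (z , z∈xy , z∈uv) with x ≟ u | x ≟ v | y ≟ u | y ≟ v
  ... | yes _ | _     | _     | _     = _
  ... | no _  | yes _ | _     | _     = _
  ... | no _  | no _  | yes _ | _     = _
  ... | no _  | no _  | no _  | yes _ = _
  ... | no x≢u | no x≢v | no y≢u | no y≢v = disjoint z∈xy z∈uv
    where
    disjoint : z ∈ₑ (x , y) → z ∈ₑ (u , v) → ⊥
    disjoint (inj₁ refl) (inj₁ refl) = x≢u refl
    disjoint (inj₁ refl) (inj₂ refl) = x≢v refl
    disjoint (inj₂ refl) (inj₁ refl) = y≢u refl
    disjoint (inj₂ refl) (inj₂ refl) = y≢v refl

  InClosedNbhd⁻ : ∀ {u v x y} → T (InClosedNbhd u v (x , y)) → Shares (x , y) (u , v)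
  InClosedNbhd⁻ {u} {v} {x} {y} h with x ≟ u | x ≟ v | y ≟ u | y ≟ v
  ... | yes x≡u | _       | _       | _       = x , inj₁ refl , inj₁ x≡u
  ... | no _    | yes x≡v | _       | _       = x , inj₁ refl , inj₂ x≡v
  ... | no _    | no _    | yes y≡u | _       = y , inj₂ refl , inj₁ y≡u
  ... | no _    | no _    | no _    | yes y≡v = y , inj₂ refl , inj₂ y≡v

module Bipartition {n : ℕ} (G : Graph n) (side : Fin n → Bool) where

  ABEdge : Fin n × Fin n → Set
  ABEdge (a , b) = side a ≡ true × adj G a b ≡ true

  Touches : Fin n × Fin n → Fin n × Fin n → Set
  Touches (a , b) (a₀ , b₀) = a ≡ a₀ ⊎ b ≡ b₀

  ConflictFreeᴬᴮ : ∀ {k} → (Fin n × Fin n → Fin k) → Set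
  ConflictFreeᴬᴮ χ = ∀ f → ABEdge f → ∃[ e ] ABEdge e × Touches e f ×
                     (∀ e′ → ABEdge e′ → Touches e′ f → χ e′ ≡ χ e → e′ ≡ e)

  orient : Fin n × Fin n → Fin n × Fin n
  orient (x , y) = if side x then (x , y) else (y , x)

  orient-true : ∀ {x y} → side x ≡ true → orient (x , y) ≡ (x , y)
  orient-true sx rewrite sx = refl

  orient-false : ∀ {x y} → side x ≡ false → orient (x , y) ≡ (y , x)
  orient-false sx rewrite sx = refl

  ∈ₑ-orient⁺ : ∀ {z} e → z ∈ₑ e → z ∈ₑ orient e
  ∈ₑ-orient⁺ (x , y) with side x
  ... | true  = id
  ... | false = Sum.swap

  ∈ₑ-orient⁻ : ∀ {z} e → z ∈ₑ orient e → z ∈ₑ e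
  ∈ₑ-orient⁻ (x , y) with side x
  ... | true  = id
  ... | false = Sum.swap

  Shares-orient⁺ : ∀ {e f} → Shares e f → Shares (orient e) (orient f)
  Shares-orient⁺ {e} {f} (z , z∈e , z∈f) = z , ∈ₑ-orient⁺ e z∈e , ∈ₑ-orient⁺ f z∈f

  Shares-orient⁻ : ∀ {e f} → Shares (orient e) (orient f) → Shares e f
  Shares-orient⁻ {e} {f} (z , z∈e , z∈f) = z , ∈ₑ-orient⁻ e z∈e , ∈ₑ-orient⁻ f z∈f

  Touches⇒Shares : ∀ {e f} → Touches e f → Shares e f
  Touches⇒Shares {a , _} (inj₁ refl) = a , inj₁ refl , inj₁ refl
  Touches⇒Shares {_ , b} (inj₂ refl) = b , inj₂ refl , inj₂ refl

  orient-injective : ∀ {x y x′ y′} → x < y → x′ < y′ →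
                     orient (x , y) ≡ orient (x′ , y′) → (x , y) ≡ (x′ , y′)
  orient-injective {x} {y} {x′} {y′} x<y x′<y′ eq with side x | side x′
  ... | true  | true  = eq
  ... | false | false = cong swap eq
  ... | true  | false = ⊥-elim (reversed x<y x′<y′ eq)
    where
    reversed : ∀ {x y x′ y′} → x < y → x′ < y′ → (x , y) ≡ (y′ , x′) → ⊥
    reversed x<y x′<y′ refl = <-asym x<y x′<y′
  ... | false | true  = ⊥-elim (reversed x<y x′<y′ eq)
    where
    reversed : ∀ {x y x′ y′} → x < y → x′ < y′ → (y , x) ≡ (x′ , y′) → ⊥
    reversed x<y x′<y′ refl = <-asym x<y x′<y′

  module _ (bip : ∀ u v → adj G u v ≡ true → side u ≢ side v) where

    otherSide : ∀ {a b} → adj G a b ≡ true → side b ≡ not (side a)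
    otherSide {a} {b} ab = ¬-not (bip b a (trans (Graph.sym G b a) ab))

    ABEdge-side₂ : ∀ {a b} → ABEdge (a , b) → side b ≡ false
    ABEdge-side₂ (sa , ab) = trans (otherSide ab) (cong not sa)

    orient-ABEdge : ∀ {x y} → adj G x y ≡ true → ABEdge (orient (x , y))
    orient-ABEdge {x} {y} xy with side x in sx
    ... | true  = sx , xy
    ... | false = trans (otherSide xy) (cong not sx) , trans (Graph.sym G y x) xy

    Shares⇒Touches : ∀ {e f} → ABEdge e → ABEdge f → Shares e f → Touches e f
    Shares⇒Touches _ _ (_ , inj₁ refl , inj₁ refl) = inj₁ refl
    Shares⇒Touches _ _ (_ , inj₂ refl , inj₂ refl) = inj₂ refl
    Shares⇒Touches (sa , _) f-AB (_ , inj₁ refl , inj₂ refl) =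
      contradiction (trans (sym sa) (ABEdge-side₂ f-AB)) λ ()
    Shares⇒Touches e-AB (sa₀ , _) (_ , inj₂ refl , inj₁ refl) =
      contradiction (trans (sym sa₀) (ABEdge-side₂ e-AB)) λ ()

    edgeOf : ∀ {e} → ABEdge e → ∃[ e′ ] e′ ∈ Edges G × orient e′ ≡ e
    edgeOf {a , b} (sa , ab) with <-cmp a b
    ... | tri< a<b _ _ = (a , b) , ∈-Edges⁺ G a<b ab , orient-true sa
    ... | tri≈ _ refl _ = contradiction (trans (sym ab) (Graph.irrefl G a)) λ ()
    ... | tri> _ _ b<a = (b , a) , ∈-Edges⁺ G b<a (trans (Graph.sym G b a) ab) ,
                         orient-false (ABEdge-side₂ (sa , ab))

    conflictFree-orient : ∀ {k} (χ : Fin n × Fin n → Fin k) → ConflictFreeᴬᴮ χ →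
                          ConflictFree G (λ x y → χ (orient (x , y)))
    conflictFree-orient χ cfᴬᴮ u v uv with cfᴬᴮ (orient (u , v)) (orient-ABEdge uv)
    ... | e , e-AB , e-touches , e-only with edgeOf e-AB
    ... | (x , y) , xy∈ , refl =
      χ (orient (x , y)) , length-filterᵇ≡1 _ (Edges-unique G) xy∈ counted only
      where
      counted : T (InClosedNbhd u v (x , y) ∧ ⌊ χ (orient (x , y)) ≟ χ (orient (x , y)) ⌋)
      counted = Equivalence.from T-∧
        (InClosedNbhd⁺ (Shares-orient⁻ (Touches⇒Shares e-touches)) , fromWitness refl)

      only : ∀ {e′} → e′ ∈ Edges G →
             T (InClosedNbhd u v e′ ∧ ⌊ χ (orient e′) ≟ χ (orient (x , y)) ⌋) → e′ ≡ (x , y)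
      only {x′ , y′} xy′∈ h =
        let (x′<y′ , x′y′) = ∈-Edges⁻ G xy′∈
            (near , sameColour) = Equivalence.to T-∧ h
            touches = Shares⇒Touches (orient-ABEdge x′y′) (orient-ABEdge uv)
                        (Shares-orient⁺ (InClosedNbhd⁻ near))
        in orient-injective x′<y′ (proj₁ (∈-Edges⁻ G xy∈))
             (e-only _ (orient-ABEdge x′y′) touches (toWitness sameColour))

module DominatingColouring {n : ℕ} (G : Graph n) (side S : Fin n → Bool) (p q : Fin n → Fin n)
  (p-dominates : ∀ a → side a ≡ true → S (p a) ≡ true × adj G a (p a) ≡ true)
  (q-private : ∀ w → S w ≡ true → PrivateNeighbour G side S w (q w)) where

  open Bipartition G side using (ABEdge; Touches; ConflictFreeᴬᴮ)

  colour : Fin n × Fin n → Fin 4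
  colour (a , b) with p a ≟ b | q b ≟ a
  ... | yes _ | yes _ = # 0
  ... | yes _ | no _  = # 1
  ... | no _  | _     = # 2

  colour≢2⇒p : ∀ {a b} → colour (a , b) ≢ # 2 → p a ≡ b
  colour≢2⇒p {a} {b} c≢2 with p a ≟ b | q b ≟ a
  ... | yes pa≡b | _ = pa≡b
  ... | no _     | _ = contradiction refl c≢2

  colour≡0⇒pq : ∀ {a b} → colour (a , b) ≡ # 0 → p a ≡ b × q b ≡ a
  colour≡0⇒pq {a} {b} c≡0 with p a ≟ b | q b ≟ a
  colour≡0⇒pq _  | yes pa≡b | yes qb≡a = pa≡b , qb≡a
  colour≡0⇒pq () | yes _    | no _
  colour≡0⇒pq () | no _     | _

  colour-p : ∀ a → colour (a , p a) ≢ # 2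
  colour-p a with p a ≟ p a | q (p a) ≟ a
  ... | yes _ | yes _ = λ ()
  ... | yes _ | no _  = λ ()
  ... | no pa≢pa | _  = contradiction refl pa≢pa

  colour-q : ∀ {w} → p (q w) ≡ w → colour (q w , w) ≡ # 0
  colour-q {w} pqw≡w with p (q w) ≟ w | q w ≟ q w
  ... | yes _ | yes _   = refl
  ... | yes _ | no qw≢qw = contradiction refl qw≢qw
  ... | no pqw≢w | _    = contradiction pqw≡w pqw≢w

  p∘q : ∀ {w} → S w ≡ true → p (q w) ≡ w
  p∘q {w} Sw = let (qw-A , _ , only-w) = q-private w Sw
                   (S-pqw , qw-pqw) = p-dominates (q w) qw-A
               in only-w (p (q w)) qw-pqw S-pqw

  privateEdge-only : ∀ {a₀ b₀} → S b₀ ≡ true → ABEdge (a₀ , b₀) →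
                     ∀ e′ → ABEdge e′ → Touches e′ (a₀ , b₀) → colour e′ ≡ # 0 → e′ ≡ (q b₀ , b₀)
  privateEdge-only _ _ (a , b) _ (inj₂ refl) c≡0 = cong (_, b) (sym (proj₂ (colour≡0⇒pq c≡0)))
  privateEdge-only {b₀ = b₀} Sb₀ (_ , a₀b₀) (a , b) (sa , _) (inj₁ refl) c≡0 =
    cong₂ _,_ (trans (sym qb≡a) (cong q (sym b₀≡b))) (sym b₀≡b)
    where
    pa≡b : p a ≡ b
    pa≡b = proj₁ (colour≡0⇒pq c≡0)

    qb≡a : q b ≡ a
    qb≡a = proj₂ (colour≡0⇒pq c≡0)

    Sb : S b ≡ true
    Sb = subst (λ w → S w ≡ true) pa≡b (proj₁ (p-dominates a sa))

    b₀≡b : b₀ ≡ b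
    b₀≡b = proj₂ (proj₂ (q-private b Sb)) b₀ (subst (λ v → adj G v b₀ ≡ true) (sym qb≡a) a₀b₀) Sb₀

  dominatorEdge-only : ∀ {a₀ b₀} → S b₀ ≡ false →
                       ∀ e′ → ABEdge e′ → Touches e′ (a₀ , b₀) → colour e′ ≡ colour (a₀ , p a₀) →
                       e′ ≡ (a₀ , p a₀)
  dominatorEdge-only _ (a , b) _ (inj₁ refl) same =
    cong (a ,_) (sym (colour≢2⇒p (colour-p a ∘ trans (sym same))))
  dominatorEdge-only {a₀} Sb₀ (a , b) (sa , _) (inj₂ refl) same =
    contradiction (trans (sym (proj₁ (p-dominates a sa))) (trans (cong S pa≡b) Sb₀)) λ ()
    where
    pa≡b : p a ≡ b
    pa≡b = colour≢2⇒p (colour-p a₀ ∘ trans (sym same))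

  conflictFreeᴬᴮ : ConflictFreeᴬᴮ colour
  conflictFreeᴬᴮ (a₀ , b₀) f-AB@(sa₀ , _) with S b₀ in Sb₀
  ... | true  = let (qb₀-A , qb₀b₀ , _) = q-private b₀ Sb₀ in
                (q b₀ , b₀) , (qb₀-A , qb₀b₀) , inj₂ refl ,
                λ e′ e′-AB touches same →
                  privateEdge-only Sb₀ f-AB e′ e′-AB touches (trans same (colour-q (p∘q Sb₀)))
  ... | false = (a₀ , p a₀) , (sa₀ , proj₂ (p-dominates a₀ sa₀)) , inj₁ refl , dominatorEdge-only Sb₀

corollary1 : ∀ (n : ℕ) (G : Graph n) → Bipartite G → NoIsolated G → CFIndexAtMost G 4
corollary1 n G (side , bip) noIsolated =
  let (S , S-dominates , S-minimal) = minimalDominatingSet G {A = side} (λ a _ → noIsolated a)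
      (p , p-dominates) = guardedChoice side id S-dominates
      (q , q-private) = guardedChoice S id (minimal⇒privateNeighbour G S-dominates S-minimal)
      open DominatingColouring G side S p q p-dominates q-private
      open Bipartition G side
  in (λ x y → colour (orient (x , y))) , conflictFree-orient bip colour conflictFreeᴬᴮ
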